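{- If $n$ is an odd positive integer, then $\lambda(n)=\lambda(2n)$.
   Context: Let $\overline{\psi}$ be the multiplicative arithmetic function with $\overline{\psi}(p^{\alpha})=p^{\alpha-1}(p+1)$ for odd primes $p$ and $\overline{\psi}(2^{\alpha})=2^{\alpha-1}$, for all positive integers $\alpha$ (so $\overline{\psi}(1)=1$). For $n>1$, $\lambda(n)$ is the unique nonnegative integer with $\overline{\psi}^{\lambda(n)}(n)=2$ (where $\overline{\psi}^k$ is the $k$-th iterate, $\overline{\psi}^0(n)=n$), and $\lambda(1)=0$. -}

module Defs where

open import Data.Nat using (ℕ; zero; suc; _+_; _*_; _∸_; _^_; _≤_; _<_)
open import Data.Nat.Divisibility using (_∣?_)
open import Data.Nat.DivMod using (_/_)
open import Data.Nat.Primality using (prime?)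
open import Data.List using (List; map; filter; upTo)
open import Data.Nat.ListAction using (product)
open import Data.Product using (_×_)
open import Data.Sum using (_⊎_)
open import Relation.Nullary using (does)
open import Relation.Binary.PropositionalEquality using (_≡_)
open import Data.Bool using (if_then_else_)

-- p-adic valuation v_p(n) for p ≥ 2 written as p = suc (suc q), with fuel
-- (fuel n suffices since p^k ∣ n, n ≥ 1 implies k ≤ n).
vpFuel : ℕ → ℕ → ℕ → ℕ
vpFuel zero    q n = 0
vpFuel (suc f) q zero = 0
vpFuel (suc f) q (suc m) =
  if does (suc (suc q) ∣? suc m)
  then suc (vpFuel f q (suc m / suc (suc q)))
  else 0

-- v_p(n) (for p ≥ 2; value 0 for p < 2, never used)
vp : ℕ → ℕ → ℕ
vp zero n = 0
vp (suc zero) n = 0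
vp (suc (suc q)) n = vpFuel n q n

ψ̄pp : ℕ → ℕ → ℕ
ψ̄pp p zero = 1
ψ̄pp 2 (suc a) = 2 ^ a
ψ̄pp p (suc a) = p ^ a * (p + 1)

primesUpTo : ℕ → List ℕ
primesUpTo n = filter prime? (upTo (suc n))

-- ψ̄(n) = ∏_{p prime, p ∣ n} ψ̄(p^{v_p(n)})  (multiplicative extension); ψ̄(1) = 1
ψ̄ : ℕ → ℕ
ψ̄ n = product (map (λ p → ψ̄pp p (vp p n)) (primesUpTo n))

iter : (ℕ → ℕ) → ℕ → ℕ → ℕ
iter f zero    n = n
iter f (suc k) n = f (iter f k n)

-- "λ(n) = k": for n = 1, k = 0; for n > 1, ψ̄^k(n) = 2
-- (k is then unique, since ψ̄(2) = 1 and ψ̄(1) = 1).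
IsLambda : ℕ → ℕ → Set
IsLambda n k = (n ≡ 1 × k ≡ 0) ⊎ (1 < n × iter ψ̄ k n ≡ 2)

{-# OPTIONS --safe #-}
-- Doubling an odd n changes only the factor at 2,
-- from ψ̄(2⁰) = 1 to ψ̄(2¹) = 1, so ψ̄(2n) = ψ̄(n) and the two orbits agree from the
-- first step on. Neither n nor 2n equals 2 unless n = 1, which is checked directly:
-- λ(1) = λ(2) = 0.
module Submission where

open import Defs
open import Data.List using (List; []; _∷_; map; filter; upTo; _++_; [_])
open import Data.List.Properties using (upTo-∷ʳ; map-++; filter-++)
open import Data.Nat using (ℕ; zero; suc; _+_; _*_; _<_; _≤_; _≟_; z≤n; s≤s; >-nonZero)
open import Data.Nat.Divisibility using (_∣_; _∤_; _∣?_; divides; ∣⇒≤; ∣n⇒∣m*n)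
open import Data.Nat.DivMod using (_/_; m/n<m; *-/-assoc; m*n/n≡m)
open import Data.Nat.ListAction using (product)
open import Data.Nat.ListAction.Properties using (product-++)
open import Data.Nat.Primality using (Prime; prime?; euclidsLemma)
open import Data.Nat.Properties
open import Data.Product using (_,_)
open import Data.Sum using (inj₁; inj₂; [_,_]′)
open import Function.Base using (_∘_)
open import Function.Bundles using (_⇔_; mk⇔)
import Function.Properties.Equivalence as ⇔
open import Relation.Binary.PropositionalEquality hiding ([_])
open import Relation.Nullary using (yes; no; contradiction)
open import Relation.Nullary.Decidable using (dec-true; dec-false)

vpFuel-∣ : ∀ f q m → suc (suc q) ∣ suc m →
           vpFuel (suc f) q (suc m) ≡ suc (vpFuel f q (suc m / suc (suc q)))
vpFuel-∣ f q m p∣m rewrite dec-true (suc (suc q) ∣? suc m) p∣m = refl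

vpFuel-∤ : ∀ f q m → suc (suc q) ∤ m → vpFuel f q m ≡ 0
vpFuel-∤ zero    q m       p∤m = refl
vpFuel-∤ (suc f) q zero    p∤m = refl
vpFuel-∤ (suc f) q (suc m) p∤m rewrite dec-false (suc (suc q) ∣? suc m) p∤m = refl

vpFuel-zero : ∀ f q → vpFuel f q 0 ≡ 0
vpFuel-zero zero    q = refl
vpFuel-zero (suc f) q = refl

-- Fuel m suffices on both sides because each step replaces m by m / p < m.
vpFuel-*-indivisible : ∀ q c → Prime (suc (suc q)) → suc (suc q) ∤ suc c →
                       ∀ f g m → m ≤ f → m ≤ g → vpFuel f q (suc c * m) ≡ vpFuel g q m
vpFuel-*-indivisible q c _ _ f g zero _ _ =
  trans (cong (vpFuel f q) (*-zeroʳ (suc c))) (trans (vpFuel-zero f q) (sym (vpFuel-zero g q)))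
vpFuel-*-indivisible q c p-prime p∤c (suc f) (suc g) (suc m) (s≤s m≤f) (s≤s m≤g)
  with suc (suc q) ∣? suc m
... | yes p∣m = begin
    vpFuel (suc f) q (suc c * suc m)
  ≡⟨ vpFuel-∣ f q _ (∣n⇒∣m*n (suc c) p∣m) ⟩
    suc (vpFuel f q (suc c * suc m / p))
  ≡⟨ cong (λ x → suc (vpFuel f q x)) (*-/-assoc (suc c) p∣m) ⟩
    suc (vpFuel f q (suc c * (suc m / p)))
  ≡⟨ cong suc (vpFuel-*-indivisible q c p-prime p∤c f g (suc m / p)
                 (≤-trans m/p≤m m≤f) (≤-trans m/p≤m m≤g)) ⟩
    suc (vpFuel g q (suc m / p))
  ≡⟨ vpFuel-∣ g q m p∣m ⟨
    vpFuel (suc g) q (suc m) ∎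
  where
  open ≡-Reasoning
  p : ℕ
  p = suc (suc q)
  m/p≤m : suc m / p ≤ m
  m/p≤m = ≤-pred (m/n<m (suc m) p (s≤s (s≤s z≤n)))
... | no p∤m = trans (vpFuel-∤ (suc f) q _ p∤cm) (sym (vpFuel-∤ (suc g) q _ p∤m))
  where
  p∤cm : suc (suc q) ∤ suc c * suc m
  p∤cm = [ p∤c , p∤m ]′ ∘ euclidsLemma (suc c) (suc m) p-prime

vp-∤ : ∀ p n → p ∤ n → vp p n ≡ 0
vp-∤ zero          n _   = refl
vp-∤ (suc zero)    n _   = refl
vp-∤ (suc (suc q)) n p∤n = vpFuel-∤ n q n p∤n

vp-*-indivisible : ∀ {p} c m → Prime p → p ∤ c → vp p (c * m) ≡ vp p m
vp-*-indivisible {suc (suc q)} zero    m _       p∤c = contradiction (divides 0 refl) p∤c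
vp-*-indivisible {suc (suc q)} (suc c) m p-prime p∤c =
  vpFuel-*-indivisible q c p-prime p∤c (suc c * m) m m (m≤n*m m (suc c)) ≤-refl

vp-2*odd : ∀ {n} → 2 ∤ n → vp 2 (2 * n) ≡ 1
vp-2*odd {zero}  2∤n = contradiction (divides 0 refl) 2∤n
vp-2*odd {suc n} 2∤n = begin
    vpFuel (suc f) 0 (2 * suc n)
  ≡⟨ vpFuel-∣ f 0 _ (divides (suc n) (*-comm 2 (suc n))) ⟩
    suc (vpFuel f 0 (2 * suc n / 2))
  ≡⟨ cong (λ x → suc (vpFuel f 0 x)) (trans (cong (_/ 2) (*-comm 2 (suc n))) (m*n/n≡m (suc n) 2)) ⟩
    suc (vpFuel f 0 (suc n))
  ≡⟨ cong suc (vpFuel-∤ f 0 (suc n) 2∤n) ⟩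
    1 ∎
  where
  open ≡-Reasoning
  f : ℕ
  f = n + 1 * suc n

ψ̄-factor : ℕ → ℕ → ℕ
ψ̄-factor n p = ψ̄pp p (vp p n)

ψ̄-factor-2*odd : ∀ {n} p → Prime p → 2 ∤ n → ψ̄-factor (2 * n) p ≡ ψ̄-factor n p
ψ̄-factor-2*odd (suc (suc zero)) _ 2∤n =
  trans (cong (ψ̄pp 2) (vp-2*odd 2∤n)) (sym (cong (ψ̄pp 2) (vp-∤ 2 _ 2∤n)))
ψ̄-factor-2*odd {n} p@(suc (suc (suc _))) p-prime _ =
  cong (ψ̄pp p) (vp-*-indivisible 2 n p-prime (λ p∣2 → <⇒≱ (s≤s (s≤s (s≤s z≤n))) (∣⇒≤ p∣2)))

ψ̄-factor-beyond : ∀ {n p} → 0 < n → n < p → ψ̄-factor n p ≡ 1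
ψ̄-factor-beyond {n} {p} 0<n n<p =
  cong (ψ̄pp p) (vp-∤ p n (λ p∣n → <⇒≱ n<p (∣⇒≤ {{>-nonZero 0<n}} p∣n)))

∏-primes : (ℕ → ℕ) → List ℕ → ℕ
∏-primes g ps = product (map g (filter prime? ps))

∏-primes-++ : ∀ g xs ys → ∏-primes g (xs ++ ys) ≡ ∏-primes g xs * ∏-primes g ys
∏-primes-++ g xs ys = begin
    product (map g (filter prime? (xs ++ ys)))
  ≡⟨ cong (λ l → product (map g l)) (filter-++ prime? xs ys) ⟩
    product (map g (filter prime? xs ++ filter prime? ys))
  ≡⟨ cong product (map-++ g (filter prime? xs) (filter prime? ys)) ⟩
    product (map g (filter prime? xs) ++ map g (filter prime? ys))
  ≡⟨ product-++ (map g (filter prime? xs)) _ ⟩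
    ∏-primes g xs * ∏-primes g ys ∎
  where open ≡-Reasoning

∏-primes-cong : ∀ {g h} xs → (∀ p → Prime p → g p ≡ h p) → ∏-primes g xs ≡ ∏-primes h xs
∏-primes-cong []       g≗h = refl
∏-primes-cong (x ∷ xs) g≗h with prime? x
... | yes x-prime = cong₂ _*_ (g≗h x x-prime) (∏-primes-cong xs g≗h)
... | no  _       = ∏-primes-cong xs g≗h

∏-primes-upTo-suc : ∀ g N → g N ≡ 1 → ∏-primes g (upTo (suc N)) ≡ ∏-primes g (upTo N)
∏-primes-upTo-suc g N gN≡1 = begin
    ∏-primes g (upTo (suc N))
  ≡⟨ cong (∏-primes g) (upTo-∷ʳ N) ⟨
    ∏-primes g (upTo N ++ [ N ])
  ≡⟨ ∏-primes-++ g (upTo N) [ N ] ⟩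
    ∏-primes g (upTo N) * ∏-primes g [ N ]
  ≡⟨ cong (∏-primes g (upTo N) *_) last≡1 ⟩
    ∏-primes g (upTo N) * 1
  ≡⟨ *-identityʳ _ ⟩
    ∏-primes g (upTo N) ∎
  where
  open ≡-Reasoning
  last≡1 : ∏-primes g [ N ] ≡ 1
  last≡1 with prime? N
  ... | yes _ = trans (*-identityʳ (g N)) gN≡1
  ... | no  _ = refl

∏-primes-upTo-+ : ∀ g M d → (∀ p → M ≤ p → g p ≡ 1) →
                  ∏-primes g (upTo (d + M)) ≡ ∏-primes g (upTo M)
∏-primes-upTo-+ g M zero    trivial = refl
∏-primes-upTo-+ g M (suc d) trivial =
  trans (∏-primes-upTo-suc g (d + M) (trivial (d + M) (m≤n+m M d)))
        (∏-primes-upTo-+ g M d trivial)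

ψ̄-2*odd : ∀ {n} → 2 ∤ n → ψ̄ (2 * n) ≡ ψ̄ n
ψ̄-2*odd {zero}  2∤n = contradiction (divides 0 refl) 2∤n
ψ̄-2*odd {n@(suc _)} 2∤n = begin
    ∏-primes (ψ̄-factor (2 * n)) (upTo (suc (2 * n)))
  ≡⟨ ∏-primes-cong (upTo (suc (2 * n))) (λ p p-prime → ψ̄-factor-2*odd p p-prime 2∤n) ⟩
    ∏-primes (ψ̄-factor n) (upTo (suc (2 * n)))
  ≡⟨ cong (λ N → ∏-primes (ψ̄-factor n) (upTo N)) (+-suc n (n + 0)) ⟨
    ∏-primes (ψ̄-factor n) (upTo (n + suc (n + 0)))
  ≡⟨ cong (λ N → ∏-primes (ψ̄-factor n) (upTo (n + suc N))) (+-identityʳ n) ⟩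
    ∏-primes (ψ̄-factor n) (upTo (n + suc n))
  ≡⟨ ∏-primes-upTo-+ (ψ̄-factor n) (suc n) n (λ p n<p → ψ̄-factor-beyond (s≤s z≤n) n<p) ⟩
    ∏-primes (ψ̄-factor n) (upTo (suc n)) ∎
  where open ≡-Reasoning

iter-suc : ∀ f k x → iter f (suc k) x ≡ iter f k (f x)
iter-suc f zero    x = refl
iter-suc f (suc k) x = cong f (iter-suc f k x)

iter-fixed : ∀ f k {x} → f x ≡ x → iter f k x ≡ x
iter-fixed f zero    fx≡x = refl
iter-fixed f (suc k) fx≡x = trans (cong f (iter-fixed f k fx≡x)) fx≡x

IsLambda-1 : ∀ {k} → IsLambda 1 k ⇔ k ≡ 0
IsLambda-1 = mk⇔ (λ { (inj₁ (_ , k≡0)) → k≡0 ; (inj₂ (s≤s () , _)) })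
                 (λ k≡0 → inj₁ (refl , k≡0))

-- ψ̄(2) = 1 and ψ̄(1) = 1, so the iterates of 2 are 2, 1, 1, …
IsLambda-2 : ∀ {k} → IsLambda 2 k ⇔ k ≡ 0
IsLambda-2 = mk⇔ to (λ { refl → inj₂ (s≤s (s≤s z≤n) , refl) })
  where
  to : ∀ {k} → IsLambda 2 k → k ≡ 0
  to {zero}  _ = refl
  to {suc k} (inj₂ (_ , ψ̄ᵏ⁺¹2≡2))
    with () ← trans (sym (trans (iter-suc ψ̄ k 2) (iter-fixed ψ̄ k refl))) ψ̄ᵏ⁺¹2≡2

IsLambda-transfer : ∀ {m n k} → 1 < m → 1 < n → m ≢ 2 → ψ̄ m ≡ ψ̄ n →
                    IsLambda m k → IsLambda n k
IsLambda-transfer 1<m _ _ _ (inj₁ (refl , _)) = contradiction 1<m (<-irrefl refl)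
IsLambda-transfer {k = zero} _ _ m≢2 _ (inj₂ (_ , m≡2)) = contradiction m≡2 m≢2
IsLambda-transfer {m} {n} {suc k} _ 1<n _ ψ̄m≡ψ̄n (inj₂ (_ , ψ̄ᵏ⁺¹m≡2)) = inj₂ (1<n , (begin
    iter ψ̄ (suc k) n  ≡⟨ iter-suc ψ̄ k n ⟩
    iter ψ̄ k (ψ̄ n)    ≡⟨ cong (iter ψ̄ k) ψ̄m≡ψ̄n ⟨
    iter ψ̄ k (ψ̄ m)    ≡⟨ iter-suc ψ̄ k m ⟨
    iter ψ̄ (suc k) m  ≡⟨ ψ̄ᵏ⁺¹m≡2 ⟩
    2                 ∎))
  where open ≡-Reasoning

IsLambda-cong : ∀ {m n k} → 1 < m → 1 < n → m ≢ 2 → n ≢ 2 → ψ̄ m ≡ ψ̄ n →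
                IsLambda m k ⇔ IsLambda n k
IsLambda-cong 1<m 1<n m≢2 n≢2 ψ̄m≡ψ̄n =
  mk⇔ (IsLambda-transfer 1<m 1<n m≢2 ψ̄m≡ψ̄n) (IsLambda-transfer 1<n 1<m n≢2 (sym ψ̄m≡ψ̄n))

lemma2p3 : (n : ℕ) → 0 < n → 2 ∤ n → (k : ℕ) → IsLambda n k ⇔ IsLambda (2 * n) k
lemma2p3 n 0<n 2∤n k with n ≟ 1
... | yes refl = ⇔.trans IsLambda-1 (⇔.sym IsLambda-2)
... | no  n≢1  = IsLambda-cong 1<n 1<2n n≢2 2n≢2 (sym (ψ̄-2*odd 2∤n))
  where
  1<n : 1 < n
  1<n = ≤∧≢⇒< 0<n (≢-sym n≢1)
  1<2n : 1 < 2 * n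
  1<2n = <-≤-trans 1<n (m≤n*m n 2)
  n≢2 : n ≢ 2
  n≢2 refl = 2∤n (divides 1 refl)
  2n≢2 : 2 * n ≢ 2
  2n≢2 2n≡2 = n≢1 (*-cancelˡ-≡ n 1 2 2n≡2)
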